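{- Let $\mu$ be a nonempty partition and let $d_s(\mu^c)$ be the largest positive integer $i$ such that $\mu^c_i\ge i-1$. Then $d_s(\mu^c)=d(\mu)$; in other words, the set of positive integers $i$ with $\mu^c_i\ge i-1$ equals the set of positive integers $i$ with $i\le d(\mu)$.
   Context: For a partition $\lambda$ set $\lambda_t=0$ for $t>\ell(\lambda)$; $d(\lambda)$ is the largest $i\ge1$ with $\lambda_i\ge i$ (length of the diagonal). The Maya diagram of $\lambda$ is $S(\lambda)=\{\lambda_t-t+\tfrac12:t\ge1\}$. For $S\subseteq\mathbb{Z}+\tfrac12$ let $S^+=\{x\in S:x>0\}$, $S^-=\{x\in(\mathbb{Z}+\tfrac12)\setminus S:x<0\}$; if finite, $c(S)=|S^+|-|S^-|$ and $\{s-c(S):s\in S\}$ is the Maya diagram of a unique partition, the partition associated to $S$. For nonempty $\mu$ with $S=S(\mu)$, $\mu^c$ is the partition associated to $S\cup\{\max S^-\}$. -}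

module Defs where

open import Level using (0ℓ)
open import Data.Nat as ℕ using (ℕ; zero; suc)
open import Data.Integer as ℤ using (ℤ; +_; _-_; _+_)
open import Data.List using (List; []; _∷_; length)
open import Data.List.Relation.Unary.All using (All)
open import Data.List.Relation.Unary.Linked using (Linked)
open import Data.List.Relation.Unary.Unique.Propositional using (Unique)
open import Data.List.Membership.Propositional using (_∈_)
open import Data.Product using (Σ; _×_; ∃; ∃-syntax)
open import Data.Sum using (_⊎_)
open import Function.Bundles using (_⇔_)
open import Relation.Nullary using (¬_)
open import Relation.Binary.PropositionalEquality using (_≡_)

record Partition : Set where
  constructor mkPartition
  field
    parts      : List ℕ
    decreasing : Linked ℕ._≥_ parts
    positive   : All (λ p → 1 ℕ.≤ p) parts
open Partition public

lookup0 : List ℕ → ℕ → ℕ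
lookup0 []       _       = 0
lookup0 (x ∷ xs) zero    = x
lookup0 (x ∷ xs) (suc n) = lookup0 xs n

-- λ_t for t ≥ 1 (λ_t = 0 for t > ℓ(λ)); the value at t = 0 is irrelevant.
part : Partition → ℕ → ℕ
part λ′ t = lookup0 (parts λ′) (t ℕ.∸ 1)

Nonempty : Partition → Set
Nonempty λ′ = 1 ℕ.≤ length (parts λ′)

IsDiagonalLength : Partition → ℕ → Set
IsDiagonalLength λ′ D =
  (1 ℕ.≤ D) × (D ℕ.≤ part λ′ D) ×
  (∀ i → 1 ℕ.≤ i → i ℕ.≤ part λ′ i → i ℕ.≤ D)

-- Subsets of ℤ + 1/2.  Encoding: the integer x stands for the half-integer x + 1/2.
-- So "x + 1/2 > 0" is "0 ≤ x", and "x + 1/2 < 0" is "x < 0".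
HSet : Set₁
HSet = ℤ → Set

Maya : Partition → HSet
Maya λ′ x = ∃[ t ] ((1 ℕ.≤ t) × (x ≡ + part λ′ t - + t))

insert : HSet → ℤ → HSet
insert S m x = S x ⊎ (x ≡ m)

Plus : HSet → HSet
Plus S x = S x × (+ 0 ℤ.≤ x)

Minus : HSet → HSet
Minus S x = (¬ S x) × (x ℤ.< + 0)

Enumerates : List ℤ → HSet → Set
Enumerates L P = Unique L × (∀ x → (x ∈ L) ⇔ P x)

HasCharge : HSet → ℤ → Set
HasCharge S c =
  Σ (List ℤ) λ L⁺ → Σ (List ℤ) λ L⁻ →
    Enumerates L⁺ (Plus S) × Enumerates L⁻ (Minus S) ×
    (c ≡ + length L⁺ - + length L⁻)

IsAssociated : HSet → Partition → Set
IsAssociated S ν =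
  ∃[ c ] (HasCharge S c × (∀ x → Maya ν x ⇔ S (x + c)))

IsMaxMinus : HSet → ℤ → Set
IsMaxMinus S m = Minus S m × (∀ x → Minus S x → x ℤ.≤ m)

IsComplement : Partition → Partition → Set
IsComplement μ ν = ∃[ m ] (IsMaxMinus (Maya μ) m × IsAssociated (insert (Maya μ) m) ν)

-- List S(λ) decreasingly as maya λ k = λ_{k+1} - (k+1) + 1/2.  The decreasing
-- enumeration of S(μ) ∪ {m}, m = max S(μ)⁻, is the enumeration of S(μ^c)
-- shifted by the charge c; far out the extra point m offsets the two lists by
-- exactly one index, which forces c = 1.  So the k-th point of S(μ) ∪ {m} is
-- μ^c_{k+1} - k + 1/2.  As m < 0, inserting m does not move the non-negative
-- points, hence μ^c_{k+1} ≥ k iff μ_{k+1} ≥ k + 1, i.e. iff k + 1 ≤ d(μ).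
module Submission where

open import Defs
open import Level using (0ℓ)
open import Data.Nat as ℕ using (ℕ; zero; suc; _≤_; _∸_; z≤n; s≤s)
import Data.Nat.Properties as ℕP
open import Data.Integer as ℤ using (ℤ; +_; -[1+_]; _⊖_; _⊔_; _⊓_; -<+; -<-)
import Data.Integer.Properties as ℤP
open import Algebra.Properties.AbelianGroup ℤP.+-0-abelianGroup
  using (∙-cancelˡ; //-rightDividesˡ)
open import Data.List using ([]; _∷_; length)
open import Data.List.Relation.Unary.Linked using (Linked; []; [-]; _∷_)
open import Data.Product using (_×_; _,_; ∃-syntax)
open import Data.Sum using (inj₁; inj₂; _⊎_)
open import Data.Empty using (⊥-elim)
open import Function.Bundles using (_⇔_; mk⇔; Equivalence)
open import Function.Properties.Equivalence using (⇔-setoid) renaming (refl to ⇔-refl)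
open import Relation.Nullary using (¬_)
open import Relation.Binary.Definitions using (tri<; tri≈; tri>)
open import Relation.Binary.PropositionalEquality
open Equivalence using (to; from)

⊔-< : ∀ {i j k} → i ℤ.< k → j ℤ.< k → i ⊔ j ℤ.< k
⊔-< {i} {j} i<k j<k with ℤP.⊔-sel i j
... | inj₁ i⊔j≡i = subst (ℤ._< _) (sym i⊔j≡i) i<k
... | inj₂ i⊔j≡j = subst (ℤ._< _) (sym i⊔j≡j) j<k

0≤⊖⇔≤ : ∀ a n → (+ 0 ℤ.≤ a ⊖ n) ⇔ (n ≤ a)
0≤⊖⇔≤ a n = mk⇔
  (λ 0≤a⊖n → ℤP.drop‿+≤+ (ℤP.0≤i-j⇒j≤i (subst (+ 0 ℤ.≤_) (sym (ℤP.m-n≡m⊖n a n)) 0≤a⊖n)))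
  (λ n≤a → subst (+ 0 ℤ.≤_) (ℤP.m-n≡m⊖n a n) (ℤP.i≤j⇒0≤j-i (ℤ.+≤+ n≤a)))

⊖-suc+1 : ∀ a k → (a ⊖ suc k) ℤ.+ + 1 ≡ a ⊖ k
⊖-suc+1 a k = begin
  (a ⊖ suc k) ℤ.+ + 1 ≡⟨ ℤP.distribˡ-⊖-+-pos 1 a (suc k) ⟩
  (a ℕ.+ 1) ⊖ suc k   ≡⟨ cong (_⊖ suc k) (ℕP.+-comm a 1) ⟩
  suc a ⊖ suc k       ≡⟨ ℤP.[1+m]⊖[1+n]≡m⊖n a k ⟩
  a ⊖ k               ∎
  where open ≡-Reasoning

StrictlyDecreasing : (ℕ → ℤ) → Set
StrictlyDecreasing f = ∀ k → f (suc k) ℤ.< f k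

module _ {f : ℕ → ℤ} (f↓ : StrictlyDecreasing f) where

  decreasing-< : ∀ {i j} → i ℕ.< j → f j ℤ.< f i
  decreasing-< {i} {suc j} (s≤s i≤j) with ℕP.m≤n⇒m<n∨m≡n i≤j
  ... | inj₁ i<j  = ℤP.<-trans (f↓ j) (decreasing-< i<j)
  ... | inj₂ refl = f↓ j

  decreasing-≤ : ∀ {i j} → i ≤ j → f j ℤ.≤ f i
  decreasing-≤ i≤j with ℕP.m≤n⇒m<n∨m≡n i≤j
  ... | inj₁ i<j  = ℤP.<⇒≤ (decreasing-< i<j)
  ... | inj₂ refl = ℤP.≤-refl

  decreasing-reflects-< : ∀ {i j} → f j ℤ.< f i → i ℕ.< j
  decreasing-reflects-< fj<fi = ℕP.≰⇒> (λ j≤i → ℤP.<⇒≱ fj<fi (decreasing-≤ j≤i))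

  decreasing-injective : ∀ {i j} → f i ≡ f j → i ≡ j
  decreasing-injective {i} {j} fi≡fj with ℕP.<-cmp i j
  ... | tri< i<j _ _   = ⊥-elim (ℤP.<-irrefl (sym fi≡fj) (decreasing-< i<j))
  ... | tri≈ _ i≡j _   = i≡j
  ... | tri> _ _ j<i   = ⊥-elim (ℤP.<-irrefl fi≡fj (decreasing-< j<i))

module _ {f g : ℕ → ℤ} (f↓ : StrictlyDecreasing f) (g↓ : StrictlyDecreasing g) where

  range⊆⇒index-≥ : (∀ k → ∃[ s ] g s ≡ f k) → ∀ k → ∃[ s ] (k ≤ s × g s ≡ f k)
  range⊆⇒index-≥ f⊆g zero with f⊆g zero
  ... | s , gs≡f0 = s , z≤n , gs≡f0
  range⊆⇒index-≥ f⊆g (suc k) with range⊆⇒index-≥ f⊆g k | f⊆g (suc k)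
  ... | s , k≤s , gs≡fk | s′ , gs′≡fk+1 =
    s′ , ℕP.≤-<-trans k≤s (decreasing-reflects-< g↓ gs′<gs) , gs′≡fk+1
    where
    gs′<gs : g s′ ℤ.< g s
    gs′<gs = subst₂ ℤ._<_ (sym gs′≡fk+1) (sym gs≡fk) (f↓ k)

sameRange⇒≡ : ∀ {f g} → StrictlyDecreasing f → StrictlyDecreasing g →
  (∀ k → ∃[ s ] g s ≡ f k) → (∀ k → ∃[ s ] f s ≡ g k) → ∀ k → f k ≡ g k
sameRange⇒≡ {f} {g} f↓ g↓ f⊆g g⊆f k
  with range⊆⇒index-≥ f↓ g↓ f⊆g k
... | s , k≤s , gs≡fk with range⊆⇒index-≥ g↓ f↓ g⊆f s
...   | s′ , s≤s′ , fs′≡gs = trans (sym gs≡fk) (cong g s≡k)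
  where
  s≡k : s ≡ k
  s≡k = ℕP.≤-antisym
    (subst (s ≤_) (decreasing-injective f↓ (trans fs′≡gs gs≡fk)) s≤s′) k≤s

module Insertion (X : ℕ → ℤ) (X↓ : StrictlyDecreasing X) (m : ℤ) (X≢m : ∀ j → X j ≢ m) where

  -- cap k = min m (X (k - 1)), reading X (-1) as +∞; merged is then the
  -- decreasing enumeration of the range of X together with m.
  cap : ℕ → ℤ
  cap zero    = m
  cap (suc k) = m ⊓ X k

  merged : ℕ → ℤ
  merged k = X k ⊔ cap k

  cap≤m : ∀ k → cap k ℤ.≤ m
  cap≤m zero    = ℤP.≤-refl
  cap≤m (suc k) = ℤP.i⊓j≤i m (X k)

  X<cap : ∀ {k} → X k ℤ.< m → X k ℤ.< cap k
  X<cap {zero} X0<m = X0<m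
  X<cap {suc k} Xk+1<m with ℤP.⊓-sel m (X k)
  ... | inj₁ m⊓Xk≡m  rewrite m⊓Xk≡m  = Xk+1<m
  ... | inj₂ m⊓Xk≡Xk rewrite m⊓Xk≡Xk = X↓ k

  merged-above : ∀ {k} → m ℤ.< X k → merged k ≡ X k
  merged-above {k} m<Xk = ℤP.i≥j⇒i⊔j≡i (ℤP.<⇒≤ (ℤP.≤-<-trans (cap≤m k) m<Xk))

  merged-below-≤ : ∀ {k} → X k ℤ.< m → merged k ℤ.≤ m
  merged-below-≤ {k} Xk<m = ℤP.⊔-lub (ℤP.<⇒≤ Xk<m) (cap≤m k)

  merged-suc-below : ∀ {k} → X k ℤ.< m → merged (suc k) ≡ X k
  merged-suc-below {k} Xk<m = begin
    X (suc k) ⊔ (m ⊓ X k) ≡⟨ cong (X (suc k) ⊔_) (ℤP.i≥j⇒i⊓j≡j (ℤP.<⇒≤ Xk<m)) ⟩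
    X (suc k) ⊔ X k       ≡⟨ ℤP.i≤j⇒i⊔j≡j (ℤP.<⇒≤ (X↓ k)) ⟩
    X k                   ∎
    where open ≡-Reasoning

  merged↓ : StrictlyDecreasing merged
  merged↓ k = ⊔-< (ℤP.<-≤-trans (X↓ k) (ℤP.i≤i⊔j (X k) (cap k))) m⊓Xk<merged
    where
    m⊓Xk<merged : m ⊓ X k ℤ.< merged k
    m⊓Xk<merged with ℤP.<-cmp m (X k)
    ... | tri< m<Xk _ _ =
      ℤP.≤-<-trans (ℤP.i⊓j≤i m (X k)) (ℤP.<-≤-trans m<Xk (ℤP.i≤i⊔j (X k) (cap k)))
    ... | tri≈ _ m≡Xk _ = ⊥-elim (X≢m k (sym m≡Xk))
    ... | tri> _ _ Xk<m =
      ℤP.≤-<-trans (ℤP.i⊓j≤j m (X k)) (ℤP.<-≤-trans (X<cap Xk<m) (ℤP.i≤j⊔i (X k) (cap k)))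

  merged-range : ∀ k → merged k ≡ m ⊎ ∃[ j ] merged k ≡ X j
  merged-range k with ℤP.⊔-sel (X k) (cap k)
  ... | inj₁ merged≡X   = inj₂ (k , merged≡X)
  ... | inj₂ merged≡cap = cap-range k merged≡cap
    where
    cap-range : ∀ k → merged k ≡ cap k → merged k ≡ m ⊎ ∃[ j ] merged k ≡ X j
    cap-range zero    merged≡m = inj₁ merged≡m
    cap-range (suc k) merged≡cap with ℤP.⊓-sel m (X k)
    ... | inj₁ cap≡m  = inj₁ (trans merged≡cap cap≡m)
    ... | inj₂ cap≡Xk = inj₂ (k , trans merged≡cap cap≡Xk)

  X∈merged : ∀ j → ∃[ k ] merged k ≡ X j
  X∈merged j with ℤP.<-cmp m (X j)
  ... | tri< m<Xj _ _ = j , merged-above m<Xj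
  ... | tri≈ _ m≡Xj _ = ⊥-elim (X≢m j (sym m≡Xj))
  ... | tri> _ _ Xj<m = suc j , merged-suc-below Xj<m

  m∈merged : ∀ {n} → X n ℤ.< m → ∃[ k ] merged k ≡ m
  m∈merged {zero} X0<m = zero , ℤP.i≤j⇒i⊔j≡j (ℤP.<⇒≤ X0<m)
  m∈merged {suc n} Xn+1<m with ℤP.<-cmp m (X n)
  ... | tri< m<Xn _ _ = suc n , (begin
    X (suc n) ⊔ (m ⊓ X n) ≡⟨ cong (X (suc n) ⊔_) (ℤP.i≤j⇒i⊓j≡i (ℤP.<⇒≤ m<Xn)) ⟩
    X (suc n) ⊔ m         ≡⟨ ℤP.i≤j⇒i⊔j≡j (ℤP.<⇒≤ Xn+1<m) ⟩
    m                     ∎)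
    where open ≡-Reasoning
  ... | tri≈ _ m≡Xn _ = ⊥-elim (X≢m n (sym m≡Xn))
  ... | tri> _ _ Xn<m = m∈merged Xn<m

  ≤merged⇔≤X : ∀ {t} → m ℤ.< t → ∀ k → (t ℤ.≤ merged k) ⇔ (t ℤ.≤ X k)
  ≤merged⇔≤X {t} m<t k with ℤP.<-cmp m (X k)
  ... | tri< m<Xk _ _ = subst (λ y → (t ℤ.≤ y) ⇔ (t ℤ.≤ X k)) (sym (merged-above m<Xk)) ⇔-refl
  ... | tri≈ _ m≡Xk _ = ⊥-elim (X≢m k (sym m≡Xk))
  ... | tri> _ _ Xk<m = mk⇔
    (λ t≤merged → ⊥-elim (ℤP.<⇒≱ m<t (ℤP.≤-trans t≤merged (merged-below-≤ Xk<m))))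
    (λ t≤Xk → ⊥-elim (ℤP.<⇒≱ m<t (ℤP.<⇒≤ (ℤP.≤-<-trans t≤Xk Xk<m))))

lookup0-suc≤ : ∀ {xs} → Linked ℕ._≥_ xs → ∀ k → lookup0 xs (suc k) ≤ lookup0 xs k
lookup0-suc≤ []                  k       = z≤n
lookup0-suc≤ [-]                 k       = z≤n
lookup0-suc≤ (x≥y ∷ _)           zero    = x≥y
lookup0-suc≤ (_ ∷ ys-decreasing) (suc k) = lookup0-suc≤ ys-decreasing k

lookup0-beyondLength : ∀ xs {k} → length xs ≤ k → lookup0 xs k ≡ 0
lookup0-beyondLength []       _               = refl
lookup0-beyondLength (_ ∷ xs) {suc k} (s≤s ℓ≤k) = lookup0-beyondLength xs ℓ≤k

maya : Partition → ℕ → ℤ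
maya λ′ k = lookup0 (parts λ′) k ⊖ suc k

maya↓ : ∀ λ′ → StrictlyDecreasing (maya λ′)
maya↓ λ′ k = ℤP.≤-<-trans
  (ℤP.⊖-monoˡ-≤ (suc (suc k)) (lookup0-suc≤ (decreasing λ′) k))
  (ℤP.⊖-monoʳ->-< (lookup0 (parts λ′) k) ℕP.≤-refl)

maya∈Maya : ∀ λ′ k → Maya λ′ (maya λ′ k)
maya∈Maya λ′ k = suc k , s≤s z≤n , refl

Maya⇒maya : ∀ λ′ {x} → Maya λ′ x → ∃[ k ] maya λ′ k ≡ x
Maya⇒maya λ′ (suc k , _ , refl) = k , refl

maya-beyondLength : ∀ λ′ {k} → length (parts λ′) ≤ k → maya λ′ k ≡ -[1+ k ]
maya-beyondLength λ′ {k} ℓ≤k = cong (_⊖ suc k) (lookup0-beyondLength (parts λ′) ℓ≤k)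

maya-eventually-< : ∀ λ′ x → ∃[ n ] maya λ′ n ℤ.< x
maya-eventually-< λ′ (+ a) =
  ℓ , subst (ℤ._< + a) (sym (maya-beyondLength λ′ ℕP.≤-refl)) -<+
  where ℓ = length (parts λ′)
maya-eventually-< λ′ -[1+ j ] =
  n , subst (ℤ._< -[1+ j ]) (sym (maya-beyondLength λ′ (ℕP.m≤m+n ℓ (suc j))))
            (-<- (ℕP.m≤n+m (suc j) ℓ))
  where
  ℓ = length (parts λ′)
  n = ℓ ℕ.+ suc j

diagonal⇔0≤maya : ∀ μ {D} → IsDiagonalLength μ D → ∀ k → (+ 0 ℤ.≤ maya μ k) ⇔ (suc k ≤ D)
diagonal⇔0≤maya μ {zero} (() , _)
diagonal⇔0≤maya μ {suc D′} (_ , D≤μD , D-max) k = mk⇔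
  (λ 0≤maya → D-max (suc k) (s≤s z≤n) (to (0≤⊖⇔≤ _ (suc k)) 0≤maya))
  (λ { (s≤s k≤D′) → ℤP.≤-trans (from (0≤⊖⇔≤ _ (suc D′)) D≤μD) (decreasing-≤ (maya↓ μ) k≤D′) })

module InsertionIntoMaya (μ : Partition) (m : ℤ) (m∉S : ¬ Maya μ m) where

  open Insertion (maya μ) (maya↓ μ) m
    (λ j maya≡m → m∉S (subst (Maya μ) maya≡m (maya∈Maya μ j))) public

  merged∈S∪m : ∀ k → insert (Maya μ) m (merged k)
  merged∈S∪m k with merged-range k
  ... | inj₁ merged≡m       = inj₂ merged≡m
  ... | inj₂ (j , merged≡X) = inj₁ (subst (Maya μ) (sym merged≡X) (maya∈Maya μ j))

  S∪m⊆merged : ∀ {x} → insert (Maya μ) m x → ∃[ k ] merged k ≡ x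
  S∪m⊆merged (inj₁ x∈S) with Maya⇒maya μ x∈S
  ... | j , refl = X∈merged j
  S∪m⊆merged (inj₂ refl) with maya-eventually-< μ m
  ... | _ , mayan<m = m∈merged mayan<m

  merged≡shift : ∀ ν {c} → (∀ x → Maya ν x ⇔ insert (Maya μ) m (x ℤ.+ c)) →
    ∀ k → merged k ≡ maya ν k ℤ.+ c
  merged≡shift ν {c} ν≅S∪m = sameRange⇒≡ merged↓ shift↓ merged⊆shift shift⊆merged
    where
    shift↓ : StrictlyDecreasing (λ k → maya ν k ℤ.+ c)
    shift↓ k = ℤP.+-monoˡ-< c (maya↓ ν k)

    merged⊆shift : ∀ k → ∃[ s ] maya ν s ℤ.+ c ≡ merged k
    merged⊆shift k with Maya⇒maya ν (from (ν≅S∪m (merged k ℤ.- c))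
      (subst (insert (Maya μ) m) (sym (//-rightDividesˡ c (merged k))) (merged∈S∪m k)))
    ... | s , mayas≡ = s , trans (cong (ℤ._+ c) mayas≡) (//-rightDividesˡ c (merged k))

    shift⊆merged : ∀ k → ∃[ s ] merged s ≡ maya ν k ℤ.+ c
    shift⊆merged k = S∪m⊆merged (to (ν≅S∪m (maya ν k)) (maya∈Maya ν k))

  -- Beyond both lengths, merged (suc K) = -[1+ K ] while maya ν (suc K) = -[1+ suc K ].
  shift≡1 : ∀ ν {c} → (∀ k → merged k ≡ maya ν k ℤ.+ c) → c ≡ + 1
  shift≡1 ν {c} merged≡ with maya-eventually-< μ m
  ... | n , mayan<m = ∙-cancelˡ -[1+ suc K ] c (+ 1) (begin
    -[1+ suc K ] ℤ.+ c   ≡⟨ cong (ℤ._+ c) (sym (maya-beyondLength ν ℓν≤K+1)) ⟩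
    maya ν (suc K) ℤ.+ c ≡⟨ sym (merged≡ (suc K)) ⟩
    merged (suc K)       ≡⟨ merged-suc-below mayaK<m ⟩
    maya μ K             ≡⟨ maya-beyondLength μ ℓμ≤K ⟩
    -[1+ K ]             ∎)
    where
    open ≡-Reasoning
    ℓμ = length (parts μ)
    ℓν = length (parts ν)
    K  = n ℕ.+ (ℓμ ℕ.+ ℓν)

    ℓμ≤K : ℓμ ≤ K
    ℓμ≤K = ℕP.≤-trans (ℕP.m≤m+n ℓμ ℓν) (ℕP.m≤n+m _ n)

    ℓν≤K+1 : ℓν ≤ suc K
    ℓν≤K+1 = ℕP.≤-trans (ℕP.m≤n+m ℓν ℓμ) (ℕP.≤-trans (ℕP.m≤n+m _ n) (ℕP.n≤1+n K))

    mayaK<m : maya μ K ℤ.< m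
    mayaK<m = ℤP.≤-<-trans (decreasing-≤ (maya↓ μ) (ℕP.m≤m+n n _)) mayan<m

  associated⇒merged≡ : ∀ ν → IsAssociated (insert (Maya μ) m) ν →
    ∀ k → merged k ≡ part ν (suc k) ⊖ k
  associated⇒merged≡ ν (c , _ , ν≅S∪m) k = begin
    merged k           ≡⟨ merged≡shift ν ν≅S∪m k ⟩
    maya ν k ℤ.+ c     ≡⟨ cong (λ c′ → maya ν k ℤ.+ c′) (shift≡1 ν (merged≡shift ν ν≅S∪m)) ⟩
    maya ν k ℤ.+ + 1   ≡⟨ ⊖-suc+1 (part ν (suc k)) k ⟩
    part ν (suc k) ⊖ k ∎
    where open ≡-Reasoning

lemma5p23 : (μ ν : Partition) → Nonempty μ → IsComplement μ ν →
    (D : ℕ) → IsDiagonalLength μ D →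
    ∀ i → 1 ≤ i → ((i ∸ 1 ≤ part ν i) ⇔ (i ≤ D))
lemma5p23 _ _ _ _ _ _ zero ()
lemma5p23 μ ν _ (m , ((m∉S , m<0) , _) , ν-assoc) D diagonal (suc k) _ = begin
  k ≤ part ν (suc k)         ≈⟨ 0≤⊖⇔≤ (part ν (suc k)) k ⟨
  + 0 ℤ.≤ part ν (suc k) ⊖ k ≡⟨ cong (+ 0 ℤ.≤_) (associated⇒merged≡ ν ν-assoc k) ⟨
  + 0 ℤ.≤ merged k           ≈⟨ ≤merged⇔≤X m<0 k ⟩
  + 0 ℤ.≤ maya μ k           ≈⟨ diagonal⇔0≤maya μ diagonal k ⟩
  suc k ≤ D                  ∎
  where
  open InsertionIntoMaya μ m m∉S
  open import Relation.Binary.Reasoning.Setoid (⇔-setoid 0ℓ)
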